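{- Let $n_1,\ldots,n_M\ge 1$ be integers, $k\in[M]$, and let positive integers $L_P$ be given for $P\in\binom{[M]}{k}$ such that $\frac{1}{L_P}\prod_{j\in P}n_j$ does not depend on the choice of $P$. Then every full $k$-dimensional multi-transversal on $\pi_M$ with parameters $\{L_P\}$ is a MOA with symbol sets $S_i=[n_i]^{\star}$, constraint $M$, strength $M-k$ and index set $\{L_P:P\in\binom{[M]}{k}\}$, with $\lambda(j_1,\ldots,j_{M-k})=L_{[M]\setminus\{j_1,\ldots,j_{M-k}\}}$; if the multi-transversal is simple, then so is the MOA. Moreover, if $T$ is a MOA with symbol sets $S_i$ where $n_i=|S_i|$, constraint $M$, strength $d$ and index set $\mathbb{L}$, then (after identifying $S_i$ with $[n_i]^{\star}$) the multiset of rows of $T$ is a full $(M-d)$-dimensional multi-transversal on $\pi_M$ with parameters $n_i$ and $L_P=\lambda([M]\setminus P)$; if $T$ is simple, so is this multi-transversal.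
   Context: For a positive integer $n$, $[n]=\{1,\ldots,n\}$ and $[n]^{\star}=\{0,1,\ldots,n-1\}$; $\pi_M=\prod_{i=1}^M[n_i]^{\star}$. A $k$-dimensional multi-transversal on $\pi_M$ with parameters $\{L_P:P\in\binom{[M]}{k}\}$ is a multiset $\mathcal{T}$ of elements of $\pi_M$ such that for every $P\in\binom{[M]}{k}$ and every choice of $b_j\in[n_j]^{\star}$ for $j\in[M]\setminus P$, the number of elements $(i_1,\ldots,i_M)$ of $\mathcal{T}$, counted with multiplicity, with $i_j=b_j$ for all $j\notin P$ is at most $L_P$. It is simple if every element has multiplicity $1$. Necessarily $|\mathcal{T}|\le L_P\prod_{j\notin P}n_j$ for every $P$; $\mathcal{T}$ is full if equality holds for at least one $P$. A mixed orthogonal array (MOA) with symbol sets $S_1,\ldots,S_M$, constraint $M$, strength $d$ and index set $\mathbb{L}$ is an $N\times M$ matrix whose $i$-th column has entries from $S_i$, such that for any $d$ distinct columns $j_1,\ldots,j_d$ every sequence in $S_{j_1}\times\cdots\times S_{j_d}$ appears exactly $\lambda(j_1,\ldots,j_d)\in\mathbb{L}$ times as a row after deleting the other $M-d$ columns. It is simple if it has no repeated rows. A MOA is identified with the multiset of its rows. -}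

module Defs where

open import Data.Nat using (ℕ; zero; suc; _*_; _≤_; _∸_)
open import Data.Bool using (true; false)
open import Data.Fin using (Fin; _≟_)
import Data.Fin as F
open import Data.Fin.Properties using (all?)
open import Data.Fin.Subset using (Subset; _∈_; _∉_; ∁; ∣_∣)
open import Data.Fin.Subset.Properties using (_∈?_)
open import Data.Vec using ([]; _∷_)
open import Data.List using (List; length; filter)
open import Data.List.Relation.Unary.AllPairs using (AllPairs)
open import Data.Product using (Σ; _×_)
open import Relation.Binary.PropositionalEquality using (_≡_)
open import Relation.Nullary using (¬_; Dec)
open import Relation.Nullary.Decidable using (¬?; _→-dec_)

-- An element of π_M = ∏_{i ∈ [M]} [n_i]^⋆ (coordinates indexed by Fin M, [n_i]^⋆ = Fin (n i)).
Point : {M : ℕ} → (Fin M → ℕ) → Set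
Point {M} n = (i : Fin M) → Fin (n i)

prodIn : {M : ℕ} → Subset M → (Fin M → ℕ) → ℕ
prodIn []           n = 1
prodIn (true ∷ P)   n = n F.zero * prodIn P (λ j → n (F.suc j))
prodIn (false ∷ P)  n = prodIn P (λ j → n (F.suc j))

AgreeOff : {M : ℕ} {n : Fin M → ℕ} → Subset M → Point n → Point n → Set
AgreeOff P b t = ∀ j → j ∉ P → t j ≡ b j

agreeOff? : {M : ℕ} {n : Fin M → ℕ} (P : Subset M) (b t : Point n) → Dec (AgreeOff P b t)
agreeOff? P b t = all? (λ j → ¬? (j ∈? P) →-dec (t j ≟ b j))

AgreeOn : {M : ℕ} {n : Fin M → ℕ} → Subset M → Point n → Point n → Set
AgreeOn D s t = ∀ j → j ∈ D → t j ≡ s j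

agreeOn? : {M : ℕ} {n : Fin M → ℕ} (D : Subset M) (s t : Point n) → Dec (AgreeOn D s t)
agreeOn? D s t = all? (λ j → (j ∈? D) →-dec (t j ≟ s j))

countOff : {M : ℕ} {n : Fin M → ℕ} → Subset M → Point n → List (Point n) → ℕ
countOff P b T = length (filter (agreeOff? P b) T)

countOn : {M : ℕ} {n : Fin M → ℕ} → Subset M → Point n → List (Point n) → ℕ
countOn D s T = length (filter (agreeOn? D s) T)

IsMultiTransversal : {M : ℕ} (n : Fin M → ℕ) (k : ℕ) (L : Subset M → ℕ) → List (Point n) → Set
IsMultiTransversal {M} n k L T =
  (P : Subset M) → ∣ P ∣ ≡ k → (b : Point n) → countOff P b T ≤ L P

IsFull : {M : ℕ} (n : Fin M → ℕ) (k : ℕ) (L : Subset M → ℕ) → List (Point n) → Set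
IsFull {M} n k L T = Σ (Subset M) (λ P → ∣ P ∣ ≡ k × length T ≡ L P * prodIn (∁ P) n)

IsFullMultiTransversal : {M : ℕ} (n : Fin M → ℕ) (k : ℕ) (L : Subset M → ℕ) → List (Point n) → Set
IsFullMultiTransversal n k L T = IsMultiTransversal n k L T × IsFull n k L T

Simple : {M : ℕ} {n : Fin M → ℕ} → List (Point n) → Set
Simple T = AllPairs (λ x y → ¬ (∀ i → x i ≡ y i)) T

-- Mixed orthogonal array (rows = list T) with symbol sets S_i = [n_i]^⋆, constraint M,
-- strength d, index set 𝕃 (a predicate on ℕ) and index function λ on sets of d columns:
-- for every set D of d distinct columns and every sequence on D, the sequence appears
-- exactly λ(D) times, and λ(D) ∈ 𝕃.
IsMOA : {M : ℕ} (n : Fin M → ℕ) (d : ℕ) (λf : Subset M → ℕ) (𝕃 : ℕ → Set) → List (Point n) → Set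
IsMOA {M} n d λf 𝕃 T =
  (D : Subset M) → ∣ D ∣ ≡ d → 𝕃 (λf D) × ((s : Point n) → countOn D s T ≡ λf D)

IndexSet : {M : ℕ} (k : ℕ) (L : Subset M → ℕ) → ℕ → Set
IndexSet {M} k L x = Σ (Subset M) (λ P → ∣ P ∣ ≡ k × L P ≡ x)

-- Both directions rest on one counting principle.  Fix a set D of coordinates and
-- call two points equivalent when they agree on D.  The list  patterns D  contains
-- exactly one point of every equivalence class, and it has ∏_{j∈D} n_j elements.
-- Double counting therefore gives, for every list T of points,
--     Σ_{s ∈ patterns D} #{t ∈ T : t agrees with s on D} = |T|.          (partition)
-- Moreover "agreeing off P" is "agreeing on ∁ P", so the fibres of a
-- multi-transversal at P are the classes of the MOA at D = ∁ P.
--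
--  * Transversal ⇒ MOA: every class at D = ∁ P has at most L_P elements, and the
--    balancing condition turns fullness at one P₀ into |T| = L_P · ∏_{j∈D} n_j.
--    By (partition) and averaging, every class has exactly L_P elements.
--  * MOA ⇒ transversal: every class has exactly λ(D) elements, which is the
--    transversal bound, and (partition) computes |T|, which is fullness.
module Submission where

open import Defs
open import Data.Nat using (ℕ; _*_; _≤_; _∸_)
open import Data.Fin using (Fin)
open import Data.Fin.Subset using (Subset; ∁; ∣_∣)
open import Data.List using (List)
open import Data.Product using (_×_)
open import Relation.Binary.PropositionalEquality using (_≡_)

open import Data.Nat using (zero; suc; _+_; NonZero; >-nonZero; z≤n; s≤s)
open import Data.Nat.Properties
  using (≤-antisym; ≤-trans; ≤-reflexive; +-mono-≤; +-monoʳ-≤; +-cancelʳ-≤; +-cancelˡ-≡;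
         *-mono-≤; *-comm; *-assoc; *-identityˡ; *-identityʳ; *-zeroʳ; *-cancelˡ-≡; m∸[m∸n]≡n; m∸n≤m;
         +-commutativeSemigroup; *-commutativeSemigroup)
open import Data.Nat.ListAction using (sum)
open import Data.Nat.Tactic.RingSolver using (solve-∀)
open import Algebra.Properties.CommutativeSemigroup +-commutativeSemigroup
  using () renaming (x∙yz≈y∙xz to m+[n+o]≡n+[m+o])
open import Algebra.Properties.CommutativeSemigroup *-commutativeSemigroup
  using () renaming (x∙yz≈y∙xz to m*[n*o]≡n*[m*o])
open import Data.Bool using (true; false)
import Data.Fin as Fin
open import Data.Fin.Subset using (_∈_; _∉_; ⊤)
open import Data.Fin.Subset.Properties using (∣∁p∣≡n∸∣p∣; x∈∁p⇒x∉p; x∉p⇒x∈∁p; x∉∁p⇒x∈p; x∈p⇒x∉∁p)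
open import Data.Vec using ([]; _∷_; here; there)
open import Data.Fin.Properties using () renaming (suc-injective to Fin-suc-injective)
open import Data.List using ([]; _∷_; [_]; _++_; map; length; filter; tabulate; allFin; cartesianProductWith)
open import Data.List.Properties
  using (length-++; length-map; length-tabulate; map-tabulate; filter-++; filter-none; filter-≐)
open import Data.List.Relation.Unary.All as All using (All; []; _∷_; lookupAny)
open import Data.List.Relation.Unary.Any using (Any; here; there)
open import Data.Product using (Σ; _,_; proj₁; proj₂)
open import Relation.Nullary using (Dec; yes; no; ¬_)
open import Relation.Unary using (Decidable)
open import Relation.Binary.PropositionalEquality using (refl; sym; trans; cong; cong₂; module ≡-Reasoning)
open import Function using (id; _∘_)
open import Data.Unit using (tt) renaming (⊤ to ⊤′)

private
  variable
    A B C : Set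

count : {P : A → Set} → Decidable P → List A → ℕ
count P? xs = length (filter P? xs)

count-cong : {P Q : A → Set} (P? : Decidable P) (Q? : Decidable Q) →
             (∀ {x} → P x → Q x) → (∀ {x} → Q x → P x) → ∀ xs → count P? xs ≡ count Q? xs
count-cong P? Q? P⇒Q Q⇒P xs = cong length (filter-≐ P? Q? (P⇒Q , Q⇒P) xs)

count-none : {P : A → Set} (P? : Decidable P) → (∀ x → ¬ P x) → ∀ xs → count P? xs ≡ 0
count-none P? ¬P xs = cong length (filter-none P? (All.universal ¬P xs))

count-++ : {P : A → Set} (P? : Decidable P) (xs ys : List A) →
           count P? (xs ++ ys) ≡ count P? xs + count P? ys
count-++ P? xs ys = trans (cong length (filter-++ P? xs ys)) (length-++ (filter P? xs))

count-map : {P : B → Set} (P? : Decidable P) (f : A → B) (xs : List A) →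
            count P? (map f xs) ≡ count (λ x → P? (f x)) xs
count-map P? f [] = refl
count-map P? f (x ∷ xs) with P? (f x)
... | yes _ = cong suc (count-map P? f xs)
... | no _  = count-map P? f xs

count-suc⇒Any : {P : A → Set} (P? : Decidable P) (xs : List A) {k : ℕ} →
                count P? xs ≡ suc k → Any P xs
count-suc⇒Any P? (x ∷ xs) eq with P? x
... | yes px = here px
... | no _   = there (count-suc⇒Any P? xs eq)

count-cartesianProductWith :
  {P : C → Set} {Q : A → Set} {R : B → Set}
  (P? : Decidable P) (Q? : Decidable Q) (R? : Decidable R) (f : A → B → C) →
  (∀ {a b} → P (f a b) → Q a × R b) → (∀ {a b} → Q a → R b → P (f a b)) →
  ∀ as bs → count P? (cartesianProductWith f as bs) ≡ count Q? as * count R? bs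
count-cartesianProductWith P? Q? R? f split join [] bs = refl
count-cartesianProductWith P? Q? R? f split join (a ∷ as) bs
  rewrite count-++ P? (map (f a) bs) (cartesianProductWith f as bs)
        | count-map P? (f a) bs
        | count-cartesianProductWith P? Q? R? f split join as bs
  with Q? a
... | yes q = cong (_+ _) (count-cong _ R? (λ p → proj₂ (split p)) (join q) bs)
... | no ¬q = cong (_+ _) (count-none _ (λ b p → ¬q (proj₁ (split p))) bs)

length-cartesianProductWith : (f : A → B → C) (as : List A) (bs : List B) →
                              length (cartesianProductWith f as bs) ≡ length as * length bs
length-cartesianProductWith f [] bs = refl
length-cartesianProductWith f (a ∷ as) bs =
  trans (length-++ (map (f a) bs))
        (cong₂ _+_ (length-map (f a) bs) (length-cartesianProductWith f as bs))

sum-map-const : (f : A → ℕ) {c : ℕ} → (∀ x → f x ≡ c) → ∀ xs → sum (map f xs) ≡ length xs * c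
sum-map-const f f≡c []       = refl
sum-map-const f f≡c (x ∷ xs) = cong₂ _+_ (f≡c x) (sum-map-const f f≡c xs)

sum-map-≤ : (f : A → ℕ) {c : ℕ} → (∀ x → f x ≤ c) → ∀ xs → sum (map f xs) ≤ length xs * c
sum-map-≤ f f≤c []       = z≤n
sum-map-≤ f f≤c (x ∷ xs) = +-mono-≤ (f≤c x) (sum-map-≤ f f≤c xs)

sum-map-tight : (f : A → ℕ) {c : ℕ} → (∀ x → f x ≤ c) →
                ∀ xs → sum (map f xs) ≡ length xs * c → All (λ x → f x ≡ c) xs
sum-map-tight f f≤c []       _  = []
sum-map-tight f {c} f≤c (x ∷ xs) eq =
  fx≡c ∷ sum-map-tight f f≤c xs (+-cancelˡ-≡ c _ _ (trans (cong (_+ rest) (sym fx≡c)) eq))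
  where
  rest : ℕ
  rest = sum (map f xs)
  fx≡c : f x ≡ c
  fx≡c = ≤-antisym (f≤c x)
           (+-cancelʳ-≤ rest c (f x)
             (≤-trans (+-monoʳ-≤ c (sum-map-≤ f f≤c xs)) (≤-reflexive (sym eq))))

sum-count-∷ : {R : A → B → Set} (R? : ∀ a b → Dec (R a b)) (b : B) (bs : List B) (as : List A) →
              sum (map (λ a → count (R? a) (b ∷ bs)) as)
              ≡ count (λ a → R? a b) as + sum (map (λ a → count (R? a) bs) as)
sum-count-∷ R? b bs [] = refl
sum-count-∷ R? b bs (a ∷ as) rewrite sum-count-∷ R? b bs as with R? a b
... | yes _ = cong suc (m+[n+o]≡n+[m+o] (count (R? a) bs) (count (λ a → R? a b) as) _)
... | no _  = m+[n+o]≡n+[m+o] (count (R? a) bs) (count (λ a → R? a b) as) _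

double-count : {R : A → B → Set} (R? : ∀ a b → Dec (R a b)) (as : List A) (bs : List B) →
               sum (map (λ a → count (R? a) bs) as) ≡ sum (map (λ b → count (λ a → R? a b) as) bs)
double-count R? as []       = trans (sum-map-const _ (λ _ → refl) as) (*-zeroʳ (length as))
double-count R? as (b ∷ bs) = trans (sum-count-∷ R? b bs as) (cong (_ +_) (double-count R? as bs))

partition-count : {R : A → B → Set} (R? : ∀ a b → Dec (R a b)) (as : List A) →
                  (∀ b → count (λ a → R? a b) as ≡ 1) →
                  ∀ bs → sum (map (λ a → count (R? a) bs) as) ≡ length bs
partition-count R? as unique bs =
  trans (double-count R? as bs) (trans (sum-map-const _ unique bs) (*-identityʳ (length bs)))

count-allFin-tail : ∀ {k} {P : Fin (suc k) → Set} (P? : Decidable P) →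
                    count P? (tabulate Fin.suc) ≡ count (λ j → P? (Fin.suc j)) (allFin k)
count-allFin-tail {k} P? =
  trans (cong (count P?) (sym (map-tabulate id Fin.suc))) (count-map P? Fin.suc (allFin k))

allFin-unique : ∀ {k} (i : Fin k) → count (i Fin.≟_) (allFin k) ≡ 1
allFin-unique {suc k} Fin.zero =
  cong suc (trans (count-allFin-tail {k} (Fin.zero Fin.≟_))
                 (count-none (λ j → Fin.zero Fin.≟ Fin.suc j) (λ _ ()) (allFin k)))
allFin-unique {suc k} (Fin.suc i) =
  trans (count-allFin-tail {k} (Fin.suc i Fin.≟_))
        (trans (count-cong _ (i Fin.≟_) Fin-suc-injective (cong Fin.suc) (allFin k)) (allFin-unique i))

cons : ∀ {M} {n : Fin (suc M) → ℕ} → Fin (n Fin.zero) → Point (n ∘ Fin.suc) → Point n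
cons a p Fin.zero    = a
cons a p (Fin.suc j) = p j

-- One representative of each class of points agreeing on D: every choice of
-- symbols on D, combined with a fixed symbol on each coordinate outside D.
patterns : ∀ {M} (n : Fin M → ℕ) → (∀ i → 1 ≤ n i) → Subset M → List (Point n)
patterns {zero}  n h []          = (λ ()) ∷ []
patterns {suc M} n h (true  ∷ D) =
  cartesianProductWith (cons {n = n}) (allFin (n Fin.zero)) (patterns (n ∘ Fin.suc) (h ∘ Fin.suc) D)
patterns {suc M} n h (false ∷ D) =
  cartesianProductWith (cons {n = n}) [ Fin.fromℕ< (h Fin.zero) ] (patterns (n ∘ Fin.suc) (h ∘ Fin.suc) D)

length-patterns : ∀ {M} (n : Fin M → ℕ) (h : ∀ i → 1 ≤ n i) (D : Subset M) →
                  length (patterns n h D) ≡ prodIn D n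
length-patterns {zero}  n h []          = refl
length-patterns {suc M} n h (true  ∷ D) =
  trans (length-cartesianProductWith (cons {n = n}) (allFin (n Fin.zero))
           (patterns (n ∘ Fin.suc) (h ∘ Fin.suc) D))
        (cong₂ _*_ (length-tabulate {n = n Fin.zero} id) (length-patterns (n ∘ Fin.suc) (h ∘ Fin.suc) D))
length-patterns {suc M} n h (false ∷ D) =
  trans (length-cartesianProductWith (cons {n = n}) [ Fin.fromℕ< (h Fin.zero) ]
           (patterns (n ∘ Fin.suc) (h ∘ Fin.suc) D))
        (trans (*-identityˡ _) (length-patterns (n ∘ Fin.suc) (h ∘ Fin.suc) D))

-- Every point agrees on D with exactly one pattern: on a coordinate of D it must
-- pick the point's own symbol, outside D there is only one choice.
patterns-unique : ∀ {M} (n : Fin M → ℕ) (h : ∀ i → 1 ≤ n i) (D : Subset M) (t : Point n) →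
                  count (λ s → agreeOn? D s t) (patterns n h D) ≡ 1
patterns-unique {zero}  n h [] t = refl
patterns-unique {suc M} n h (true ∷ D) t =
  trans (count-cartesianProductWith (λ s → agreeOn? (true ∷ D) s t) (t Fin.zero Fin.≟_)
           (λ p → agreeOn? D p (t ∘ Fin.suc)) cons split join
           (allFin (n Fin.zero)) (patterns (n ∘ Fin.suc) (h ∘ Fin.suc) D))
        (cong₂ _*_ (allFin-unique (t Fin.zero)) (patterns-unique (n ∘ Fin.suc) (h ∘ Fin.suc) D (t ∘ Fin.suc)))
  where
  split : ∀ {a p} → AgreeOn (true ∷ D) (cons {n = n} a p) t → t Fin.zero ≡ a × AgreeOn D p (t ∘ Fin.suc)
  split ag = ag Fin.zero here , λ j j∈D → ag (Fin.suc j) (there j∈D)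
  join : ∀ {a p} → t Fin.zero ≡ a → AgreeOn D p (t ∘ Fin.suc) → AgreeOn (true ∷ D) (cons {n = n} a p) t
  join eq ag Fin.zero    here        = eq
  join eq ag (Fin.suc j) (there j∈D) = ag j j∈D
patterns-unique {suc M} n h (false ∷ D) t =
  trans (count-cartesianProductWith (λ s → agreeOn? (false ∷ D) s t) (λ _ → yes tt)
           (λ p → agreeOn? D p (t ∘ Fin.suc)) cons split join
           [ Fin.fromℕ< (h Fin.zero) ] (patterns (n ∘ Fin.suc) (h ∘ Fin.suc) D))
        (trans (*-identityˡ _) (patterns-unique (n ∘ Fin.suc) (h ∘ Fin.suc) D (t ∘ Fin.suc)))
  where
  split : ∀ {a p} → AgreeOn (false ∷ D) (cons {n = n} a p) t → ⊤′ × AgreeOn D p (t ∘ Fin.suc)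
  split ag = tt , λ j j∈D → ag (Fin.suc j) (there j∈D)
  join : ∀ {a p} → ⊤′ → AgreeOn D p (t ∘ Fin.suc) → AgreeOn (false ∷ D) (cons {n = n} a p) t
  join _ ag (Fin.suc j) (there j∈D) = ag j j∈D

countOn-cong : ∀ {M} {n : Fin M → ℕ} (D : Subset M) {s s′ : Point n} →
               AgreeOn D s′ s → ∀ T → countOn D s T ≡ countOn D s′ T
countOn-cong D {s} {s′} s∼s′ T =
  count-cong (agreeOn? D s) (agreeOn? D s′)
    (λ t∼s j j∈D → trans (t∼s j j∈D) (s∼s′ j j∈D))
    (λ t∼s′ j j∈D → trans (t∼s′ j j∈D) (sym (s∼s′ j j∈D))) T

classes-partition : ∀ {M} (n : Fin M → ℕ) (h : ∀ i → 1 ≤ n i) (D : Subset M) (T : List (Point n)) →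
                    sum (map (λ s → countOn D s T) (patterns n h D)) ≡ length T
classes-partition n h D T =
  partition-count (λ s t → agreeOn? D s t) (patterns n h D) (patterns-unique n h D) T

classes-size : ∀ {M} (n : Fin M → ℕ) (h : ∀ i → 1 ≤ n i) (D : Subset M) (T : List (Point n)) {c : ℕ} →
               (∀ s → countOn D s T ≡ c) → length T ≡ c * prodIn D n
classes-size n h D T {c} class≡c = begin
  length T                                              ≡⟨ classes-partition n h D T ⟨
  sum (map (λ s → countOn D s T) (patterns n h D))      ≡⟨ sum-map-const _ class≡c (patterns n h D) ⟩
  length (patterns n h D) * c                           ≡⟨ cong (_* c) (length-patterns n h D) ⟩
  prodIn D n * c                                        ≡⟨ *-comm (prodIn D n) c ⟩
  c * prodIn D n                                        ∎
  where open ≡-Reasoning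

classes-equal : ∀ {M} (n : Fin M → ℕ) (h : ∀ i → 1 ≤ n i) (D : Subset M) (T : List (Point n)) {c : ℕ} →
                (∀ s → countOn D s T ≤ c) → length T ≡ c * prodIn D n → ∀ s → countOn D s T ≡ c
classes-equal n h D T {c} class≤c size s =
  let (class≡c , s∼s′) = lookupAny allClasses≡c representative in trans (countOn-cong D s∼s′ T) class≡c
  where
  open ≡-Reasoning
  total : sum (map (λ s′ → countOn D s′ T) (patterns n h D)) ≡ length (patterns n h D) * c
  total = begin
    sum (map (λ s′ → countOn D s′ T) (patterns n h D)) ≡⟨ classes-partition n h D T ⟩
    length T                                            ≡⟨ size ⟩
    c * prodIn D n                                      ≡⟨ *-comm c (prodIn D n) ⟩
    prodIn D n * c                                      ≡⟨ cong (_* c) (length-patterns n h D) ⟨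
    length (patterns n h D) * c                         ∎
  allClasses≡c : All (λ s′ → countOn D s′ T ≡ c) (patterns n h D)
  allClasses≡c = sum-map-tight _ class≤c (patterns n h D) total
  representative : Any (λ s′ → AgreeOn D s′ s) (patterns n h D)
  representative = count-suc⇒Any (λ s′ → agreeOn? D s′ s) (patterns n h D) (patterns-unique n h D s)

countOff≡countOn : ∀ {M} {n : Fin M → ℕ} (P D : Subset M) →
                   (∀ {j} → j ∉ P → j ∈ D) → (∀ {j} → j ∈ D → j ∉ P) →
                   ∀ (b : Point n) T → countOff P b T ≡ countOn D b T
countOff≡countOn P D off⇒on on⇒off b T =
  count-cong (agreeOff? P b) (agreeOn? D b)
    (λ t∼b j j∈D → t∼b j (on⇒off j∈D)) (λ t∼b j j∉P → t∼b j (off⇒on j∉P)) T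

∣∁∣≡ : ∀ {M k} (D : Subset M) → k ≤ M → ∣ D ∣ ≡ M ∸ k → ∣ ∁ D ∣ ≡ k
∣∁∣≡ {M} D k≤M ∣D∣ = trans (∣∁p∣≡n∸∣p∣ D) (trans (cong (M ∸_) ∣D∣) (m∸[m∸n]≡n k≤M))

subset-of-size : ∀ M d → d ≤ M → Σ (Subset M) (λ D → ∣ D ∣ ≡ d)
subset-of-size zero    zero    _         = [] , refl
subset-of-size (suc M) zero    _         = let (D , ∣D∣) = subset-of-size M zero z≤n in false ∷ D , ∣D∣
subset-of-size (suc M) (suc d) (s≤s d≤M) = let (D , ∣D∣) = subset-of-size M d d≤M in true ∷ D , cong suc ∣D∣

prodIn-∁ : ∀ {M} (P : Subset M) (n : Fin M → ℕ) → prodIn P n * prodIn (∁ P) n ≡ prodIn ⊤ n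
prodIn-∁ []          n = refl
prodIn-∁ (true  ∷ P) n =
  trans (*-assoc (n Fin.zero) _ _) (cong (n Fin.zero *_) (prodIn-∁ P (n ∘ Fin.suc)))
prodIn-∁ (false ∷ P) n =
  trans (m*[n*o]≡n*[m*o] (prodIn P (n ∘ Fin.suc)) (n Fin.zero) _)
        (cong (n Fin.zero *_) (prodIn-∁ P (n ∘ Fin.suc)))

prodIn-pos : ∀ {M} (P : Subset M) (n : Fin M → ℕ) → (∀ i → 1 ≤ n i) → 1 ≤ prodIn P n
prodIn-pos []          n h = s≤s z≤n
prodIn-pos (true  ∷ P) n h = *-mono-≤ (h Fin.zero) (prodIn-pos P (n ∘ Fin.suc) (h ∘ Fin.suc))
prodIn-pos (false ∷ P) n h = prodIn-pos P (n ∘ Fin.suc) (h ∘ Fin.suc)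

-- The arithmetic of the balancing condition: if N = x·x′ = y·y′ > 0 and x′·ℓ = y·ℓ′,
-- then ℓ·y′ = ℓ′·x.  (With x, x′ the products on and off D and y, y′ those on and off P₀,
-- it turns fullness at P₀ into |T| = L_{∁D} · ∏_{j∈D} n_j.)
balance : ∀ {x x′ y y′ ℓ ℓ′ N : ℕ} .{{_ : NonZero N}} →
          x * x′ ≡ N → y * y′ ≡ N → x′ * ℓ ≡ y * ℓ′ → ℓ * y′ ≡ ℓ′ * x
balance {x} {x′} {y} {y′} {ℓ} {ℓ′} {N} xx′≡N yy′≡N x′ℓ≡yℓ′ =
  *-cancelˡ-≡ (ℓ * y′) (ℓ′ * x) N (begin
    N * (ℓ * y′)        ≡⟨ cong (_* (ℓ * y′)) xx′≡N ⟨
    x * x′ * (ℓ * y′)   ≡⟨ regroup₁ x x′ ℓ y′ ⟩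
    x * (x′ * ℓ) * y′   ≡⟨ cong (λ z → x * z * y′) x′ℓ≡yℓ′ ⟩
    x * (y * ℓ′) * y′   ≡⟨ regroup₂ x y ℓ′ y′ ⟩
    y * y′ * (ℓ′ * x)   ≡⟨ cong (_* (ℓ′ * x)) yy′≡N ⟩
    N * (ℓ′ * x)        ∎)
  where
  open ≡-Reasoning
  regroup₁ : ∀ a b c d → a * b * (c * d) ≡ a * (b * c) * d
  regroup₁ = solve-∀
  regroup₂ : ∀ a b c d → a * (b * c) * d ≡ b * d * (c * a)
  regroup₂ = solve-∀

fullMultiTransversal⇒MOA :
  ∀ {M} (n : Fin M → ℕ) → (∀ i → 1 ≤ n i) → (k : ℕ) → k ≤ M → (L : Subset M → ℕ) →
  ((P Q : Subset M) → ∣ P ∣ ≡ k → ∣ Q ∣ ≡ k → prodIn P n * L Q ≡ prodIn Q n * L P) →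
  (T : List (Point n)) → IsFullMultiTransversal n k L T →
  IsMOA n (M ∸ k) (λ D → L (∁ D)) (IndexSet k L) T
fullMultiTransversal⇒MOA n h k k≤M L balanced T (transversal , P₀ , ∣P₀∣ , full) D ∣D∣ =
  (∁ D , ∣∁D∣ , refl) , classes-equal n h D T class≤L size
  where
  ∣∁D∣ : ∣ ∁ D ∣ ≡ k
  ∣∁D∣ = ∣∁∣≡ D k≤M ∣D∣
  class≤L : ∀ s → countOn D s T ≤ L (∁ D)
  class≤L s = ≤-trans (≤-reflexive (sym (countOff≡countOn (∁ D) D x∉∁p⇒x∈p x∈p⇒x∉∁p s T)))
                      (transversal (∁ D) ∣∁D∣ s)
  size : length T ≡ L (∁ D) * prodIn D n
  size = trans full (balance {x = prodIn D n} {y = prodIn P₀ n} {ℓ = L P₀} {ℓ′ = L (∁ D)}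
                       {{>-nonZero (prodIn-pos ⊤ n h)}}
                       (prodIn-∁ D n) (prodIn-∁ P₀ n) (balanced (∁ D) P₀ ∣∁D∣ ∣P₀∣))

MOA⇒fullMultiTransversal :
  ∀ {M} (n : Fin M → ℕ) → (∀ i → 1 ≤ n i) → (d : ℕ) → d ≤ M →
  (λf : Subset M → ℕ) (𝕃 : ℕ → Set) (T : List (Point n)) → IsMOA n d λf 𝕃 T →
  IsFullMultiTransversal n (M ∸ d) (λ P → λf (∁ P)) T
MOA⇒fullMultiTransversal {M} n h d d≤M λf 𝕃 T moa = transversal , P₀ , ∣P₀∣ , full
  where
  class≡λ : ∀ P → ∣ P ∣ ≡ M ∸ d → ∀ s → countOn (∁ P) s T ≡ λf (∁ P)
  class≡λ P ∣P∣ = proj₂ (moa (∁ P) (∣∁∣≡ P d≤M ∣P∣))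
  transversal : IsMultiTransversal n (M ∸ d) (λ P → λf (∁ P)) T
  transversal P ∣P∣ b =
    ≤-reflexive (trans (countOff≡countOn P (∁ P) x∉p⇒x∈∁p x∈∁p⇒x∉p b T) (class≡λ P ∣P∣ b))
  P₀ : Subset M
  P₀ = proj₁ (subset-of-size M (M ∸ d) (m∸n≤m M d))
  ∣P₀∣ : ∣ P₀ ∣ ≡ M ∸ d
  ∣P₀∣ = proj₂ (subset-of-size M (M ∸ d) (m∸n≤m M d))
  full : length T ≡ λf (∁ P₀) * prodIn (∁ P₀) n
  full = classes-size n h (∁ P₀) T (class≡λ P₀ ∣P₀∣)

-- Proposition 2.1.  Simplicity is a property of the list of rows alone, so it
-- transfers unchanged in both directions.
proposition2p1 : (M : ℕ) (n : Fin M → ℕ) → (∀ i → 1 ≤ n i) →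
    ( (k : ℕ) → 1 ≤ k → k ≤ M → (L : Subset M → ℕ) →
    ((P : Subset M) → ∣ P ∣ ≡ k → 1 ≤ L P) →
    ((P Q : Subset M) → ∣ P ∣ ≡ k → ∣ Q ∣ ≡ k → prodIn P n * L Q ≡ prodIn Q n * L P) →
    (T : List (Point n)) → IsFullMultiTransversal n k L T →
    IsMOA n (M ∸ k) (λ D → L (∁ D)) (IndexSet k L) T × (Simple T → Simple T) )
    × ( (d : ℕ) → d ≤ M → (λf : Subset M → ℕ) (𝕃 : ℕ → Set) →
    (T : List (Point n)) → IsMOA n d λf 𝕃 T →
    IsFullMultiTransversal n (M ∸ d) (λ P → λf (∁ P)) T × (Simple T → Simple T) )
proposition2p1 M n h =
    (λ k _ k≤M L _ balanced T fullTransversal →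
       fullMultiTransversal⇒MOA n h k k≤M L balanced T fullTransversal , id)
  , (λ d d≤M λf 𝕃 T moa →
       MOA⇒fullMultiTransversal n h d d≤M λf 𝕃 T moa , id)
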